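{- There is an algorithm that, given a finite PTI net $N=(S,A,T,I)$ and a place relation $R\subseteq S\times S$, decides whether $R$ is a pti-place bisimulation.
   Context: Multisets over a finite set $S$ are functions $m:S\to\mathbb{N}$; $\mathcal{M}(S)$ is their set, $\theta$ the empty multiset, $\subseteq$ pointwise order, $\oplus$ pointwise sum, $(m\ominus m')(s)=\max\{m(s)-m'(s),0\}$, $\mathit{dom}(m)=\{s\mid m(s)\ne0\}$; a place $s$ also denotes the singleton multiset. A finite PTI net is $N=(S,A,T,I)$ with finite places $S$, finite labels $A$, finite transitions $T\subseteq(\mathcal{M}(S)\setminus\{\theta\})\times A\times(\mathcal{M}(S)\setminus\{\theta\})$ and inhibiting relation $I\subseteq S\times T$. For $t=(m,\ell,m')$: ${}^\bullet t=m$, $l(t)=\ell$, $t^\bullet=m'$, ${}^\circ t=\{s\mid(s,t)\in I\}$. $t$ is enabled at marking $m$ if ${}^\bullet t\subseteq m$ and ${}^\circ t\cap\mathit{dom}(m)=\emptyset$, and then $m[t\rangle m'$ with $m'=(m\ominus{}^\bullet t)\oplus t^\bullet$. For $R\subseteq S\times S$, $R^\oplus$ is the least relation on $\mathcal{M}(S)$ with $(\theta,\theta)\in R^\oplus$ and $(s_1\oplus m_1,s_2\oplus m_2)\in R^\oplus$ whenever $(s_1,s_2)\in R$ and $(m_1,m_2)\in R^\oplus$. $R$ is a pti-place bisimulation if for all (infinitely many possible) pairs $(m_1,m_2)\in R^\oplus$: (1) for every $t_1$ with $m_1[t_1\rangle m_1'$ there is $t_2$ with $m_2[t_2\rangle m_2'$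 such that (a) $({}^\bullet t_1,{}^\bullet t_2)\in R^\oplus$, $(t_1^\bullet,t_2^\bullet)\in R^\oplus$, $l(t_1)=l(t_2)$, $(m_1\ominus{}^\bullet t_1,m_2\ominus{}^\bullet t_2)\in R^\oplus$, and (b) for all $(s,s')\in R$, $s\in{}^\circ t_1\iff s'\in{}^\circ t_2$; (2) symmetrically, for every $t_2$ with $m_2[t_2\rangle m_2'$ there is $t_1$ with $m_1[t_1\rangle m_1'$ satisfying (a) and (b). -}

module Defs where

open import Data.Nat using (ℕ; zero; suc; _+_; _∸_; _≤_)
open import Data.Fin using (Fin; _≟_)
open import Data.Vec using (Vec; replicate; zipWith; tabulate; lookup)
open import Data.Bool using (Bool; true; false)
open import Data.Product using (Σ; _×_; _,_)
open import Relation.Nullary using (¬_; does)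
open import Relation.Binary.PropositionalEquality using (_≡_)

-- Multisets over the finite set of places Fin n, as vectors of
-- multiplicities (a function Fin n → ℕ given by its table, so that
-- propositional equality is extensional equality of multisets).
Multiset : ℕ → Set
Multiset n = Vec ℕ n

θ : ∀ {n} → Multiset n
θ = replicate _ 0

_⊕_ : ∀ {n} → Multiset n → Multiset n → Multiset n
_⊕_ = zipWith _+_

_⊖_ : ∀ {n} → Multiset n → Multiset n → Multiset n
_⊖_ = zipWith _∸_

_⊆_ : ∀ {n} → Multiset n → Multiset n → Set
m ⊆ m' = ∀ i → lookup m i ≤ lookup m' i

⟦_⟧ : ∀ {n} → Fin n → Multiset n
⟦ s ⟧ = tabulate (λ i → if does (i ≟ s) then 1 else 0)
  where
  if_then_else_ : {A : Set} → Bool → A → A → A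
  if true then x else y = x
  if false then x else y = y

_∈dom_ : ∀ {n} → Fin n → Multiset n → Set
s ∈dom m = ¬ (lookup m s ≡ 0)

-- A finite PTI net N = (S, A, T, I): places S = Fin nS, labels A = Fin nA,
-- transitions T indexed by Fin nT (pre-set, label, post-set), pairwise
-- distinct as triples (T is a set of triples), with non-empty pre/post-sets,
-- and the inhibiting relation I ⊆ S × T given as a Boolean table.
record PTINet : Set where
  field
    nS nA nT : ℕ
    pre      : Fin nT → Multiset nS
    lab      : Fin nT → Fin nA
    post     : Fin nT → Multiset nS
    pre≢θ    : ∀ t → ¬ (pre t ≡ θ)
    post≢θ   : ∀ t → ¬ (post t ≡ θ)
    distinct : ∀ t t' → pre t ≡ pre t' → lab t ≡ lab t' → post t ≡ post t' → t ≡ t'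
    inh      : Fin nS → Fin nT → Bool

PlaceRel : ℕ → Set
PlaceRel n = Fin n → Fin n → Bool

data _⊕[_]_ {n : ℕ} : Multiset n → PlaceRel n → Multiset n → Set where
  base : ∀ {R} → θ ⊕[ R ] θ
  step : ∀ {R s₁ s₂ m₁ m₂} → R s₁ s₂ ≡ true → m₁ ⊕[ R ] m₂ →
         (⟦ s₁ ⟧ ⊕ m₁) ⊕[ R ] (⟦ s₂ ⟧ ⊕ m₂)

module _ (N : PTINet) where
  open PTINet N

  Enabled : Multiset nS → Fin nT → Set
  Enabled m t = pre t ⊆ m × (∀ s → inh s t ≡ true → ¬ (s ∈dom m))

  Matches : PlaceRel nS → Multiset nS → Fin nT → Multiset nS → Fin nT → Set
  Matches R m₁ t₁ m₂ t₂ =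
      (pre t₁ ⊕[ R ] pre t₂)
    × (post t₁ ⊕[ R ] post t₂)
    × (lab t₁ ≡ lab t₂)
    × ((m₁ ⊖ pre t₁) ⊕[ R ] (m₂ ⊖ pre t₂))
    × (∀ s s' → R s s' ≡ true →
         (inh s t₁ ≡ true → inh s' t₂ ≡ true) × (inh s' t₂ ≡ true → inh s t₁ ≡ true))

  IsPtiPlaceBisim : PlaceRel nS → Set
  IsPtiPlaceBisim R = ∀ m₁ m₂ → m₁ ⊕[ R ] m₂ →
      (∀ t₁ → Enabled m₁ t₁ → Σ (Fin nT) λ t₂ → Enabled m₂ t₂ × Matches R m₁ t₁ m₂ t₂)
    × (∀ t₂ → Enabled m₂ t₂ → Σ (Fin nT) λ t₁ → Enabled m₁ t₁ × Matches R m₁ t₁ m₂ t₂)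

-- Matching a transition only ever involves its preset, so it suffices to check the forward
-- transfer condition, for R and for its converse, at the pairs (•t, m) with •t R^⊕ m: a pair
-- m₁ R^⊕ m₂ at which t₁ is enabled splits as (•t₁ ⊕ r₁, p ⊕ r₂) with •t₁ R^⊕ p and r₁ R^⊕ r₂;
-- a transition t₂ matching t₁ at (•t₁, p) has •t₂ = p, so it matches t₁ at (m₁, m₂) as well,
-- and it is not inhibited at m₂ because every place of m₂ is R-related to a place of m₁.
-- R^⊕ preserves size, so these m are bounded by size •t and can be enumerated; R^⊕ itself is
-- decided by removing related pairs of places one at a time.
module Submission where

open import Defs
open import Relation.Nullary using (Dec)

open import Data.Bool as Bool using (true)
open import Data.Fin as Fin using (Fin; zero; suc)
open import Data.Fin.Properties using (all?; any?)
open import Data.Nat as ℕ using (ℕ; zero; suc; _+_; _≤_; _<_; z≤n; s≤s)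
open import Data.Nat.Properties
open import Algebra.Properties.CommutativeSemigroup +-commutativeSemigroup using (interchange)
open import Data.Product using (∃; ∃₂; _×_; _,_; proj₁; proj₂; swap)
open import Data.Sum using (_⊎_; inj₁; inj₂; [_,_]′)
open import Data.Vec using ([]; _∷_; lookup; sum; tabulate)
open import Data.Vec.Properties
  using (lookup-zipWith; lookup-replicate; lookup∘tabulate; zipWith-comm; zipWith-assoc; zipWith-identityʳ; ≡-dec)
open import Data.Vec.Relation.Binary.Pointwise.Extensional using (ext; Pointwise-≡⇒≡)
open import Function using (_∘_; flip; _⇔_; mk⇔)
open import Relation.Binary.PropositionalEquality
open import Relation.Nullary using (¬_; yes; no; contradiction)
open import Relation.Nullary.Decidable as Dec using (map′; _×-dec_; _→-dec_; ¬?)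

private
  variable
    n : ℕ
    i s s₁ s₂ : Fin n
    a b c m₁ m₂ : Multiset n
    R : PlaceRel n

≗⇒≡ : (∀ i → lookup a i ≡ lookup b i) → a ≡ b
≗⇒≡ a≗b = Pointwise-≡⇒≡ (ext a≗b)

lookup-⊕ : ∀ (a b : Multiset n) i → lookup (a ⊕ b) i ≡ lookup a i + lookup b i
lookup-⊕ a b i = lookup-zipWith _+_ i a b

lookup-⊖ : ∀ (a b : Multiset n) i → lookup (a ⊖ b) i ≡ lookup a i ℕ.∸ lookup b i
lookup-⊖ a b i = lookup-zipWith ℕ._∸_ i a b

lookup-θ : ∀ (i : Fin n) → lookup θ i ≡ 0
lookup-θ i = lookup-replicate i 0

-- ⟦ zero ⟧ computes to 1 ∷ tabulate (λ _ → 0) and ⟦ suc s ⟧ to 0 ∷ ⟦ s ⟧.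
lookup-⟦⟧-≡ : ∀ (s : Fin n) → lookup ⟦ s ⟧ s ≡ 1
lookup-⟦⟧-≡ zero    = refl
lookup-⟦⟧-≡ (suc s) = lookup-⟦⟧-≡ s

lookup-⟦⟧-≢ : ∀ (i s : Fin n) → i ≢ s → lookup ⟦ s ⟧ i ≡ 0
lookup-⟦⟧-≢ zero    zero    i≢s = contradiction refl i≢s
lookup-⟦⟧-≢ zero    (suc s) _   = refl
lookup-⟦⟧-≢ (suc i) zero    _   = lookup∘tabulate _ i
lookup-⟦⟧-≢ (suc i) (suc s) i≢s = lookup-⟦⟧-≢ i s (i≢s ∘ cong suc)

⊕-comm : ∀ (a b : Multiset n) → a ⊕ b ≡ b ⊕ a
⊕-comm = zipWith-comm +-comm

⊕-assoc : ∀ (a b c : Multiset n) → (a ⊕ b) ⊕ c ≡ a ⊕ (b ⊕ c)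
⊕-assoc = zipWith-assoc +-assoc

⊕-identityʳ : ∀ (a : Multiset n) → a ⊕ θ ≡ a
⊕-identityʳ = zipWith-identityʳ +-identityʳ

⊕-cancelˡ : ∀ (a : Multiset n) → a ⊕ b ≡ a ⊕ c → b ≡ c
⊕-cancelˡ {b = b} {c} a eq = ≗⇒≡ λ i → +-cancelˡ-≡ (lookup a i) _ _ (begin
  lookup a i + lookup b i  ≡⟨ lookup-⊕ a b i ⟨
  lookup (a ⊕ b) i         ≡⟨ cong (flip lookup i) eq ⟩
  lookup (a ⊕ c) i         ≡⟨ lookup-⊕ a c i ⟩
  lookup a i + lookup c i  ∎)
  where open ≡-Reasoning

m⊕n⊖m≡n : ∀ (a b : Multiset n) → (a ⊕ b) ⊖ a ≡ b
m⊕n⊖m≡n a b = ≗⇒≡ λ i → begin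
  lookup ((a ⊕ b) ⊖ a) i                ≡⟨ lookup-⊖ (a ⊕ b) a i ⟩
  lookup (a ⊕ b) i ℕ.∸ lookup a i       ≡⟨ cong (ℕ._∸ lookup a i) (lookup-⊕ a b i) ⟩
  lookup a i + lookup b i ℕ.∸ lookup a i ≡⟨ m+n∸m≡n (lookup a i) (lookup b i) ⟩
  lookup b i                            ∎
  where open ≡-Reasoning

m⊕[n⊖m]≡n : ∀ (a b : Multiset n) → a ⊆ b → a ⊕ (b ⊖ a) ≡ b
m⊕[n⊖m]≡n a b a⊆b = ≗⇒≡ λ i → begin
  lookup (a ⊕ (b ⊖ a)) i                  ≡⟨ lookup-⊕ a (b ⊖ a) i ⟩
  lookup a i + lookup (b ⊖ a) i            ≡⟨ cong (lookup a i +_) (lookup-⊖ b a i) ⟩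
  lookup a i + (lookup b i ℕ.∸ lookup a i) ≡⟨ m+[n∸m]≡n (a⊆b i) ⟩
  lookup b i                              ∎
  where open ≡-Reasoning

m⊖m≡θ : ∀ (a : Multiset n) → a ⊖ a ≡ θ
m⊖m≡θ a = ≗⇒≡ λ i → trans (lookup-⊖ a a i) (trans (n∸n≡0 (lookup a i)) (sym (lookup-θ i)))

m⊆m⊕n : ∀ (a b : Multiset n) → a ⊆ (a ⊕ b)
m⊆m⊕n a b i = subst (lookup a i ≤_) (sym (lookup-⊕ a b i)) (m≤m+n _ _)

n⊆m⊕n : ∀ (a b : Multiset n) → b ⊆ (a ⊕ b)
n⊆m⊕n a b i = subst (lookup b i ≤_) (sym (lookup-⊕ a b i)) (m≤n+m _ _)

_⊆?_ : ∀ (a b : Multiset n) → Dec (a ⊆ b)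
a ⊆? b = all? λ i → lookup a i ≤? lookup b i

_∈dom?_ : ∀ (s : Fin n) (m : Multiset n) → Dec (s ∈dom m)
s ∈dom? m = ¬? (lookup m s ℕ.≟ 0)

∈dom-⊆ : ∀ (a b : Multiset n) → a ⊆ b → s ∈dom a → s ∈dom b
∈dom-⊆ {s = s} a b a⊆b s∈a s∉b = s∈a (n≤0⇒n≡0 (subst (lookup a s ≤_) s∉b (a⊆b s)))

∈dom-⟦⟧ : ∀ (s : Fin n) → s ∈dom ⟦ s ⟧
∈dom-⟦⟧ s s∉⟦s⟧ = 1+n≢0 (trans (sym (lookup-⟦⟧-≡ s)) s∉⟦s⟧)

∈dom-⟦⟧⊕ : ∀ (s : Fin n) m → s ∈dom (⟦ s ⟧ ⊕ m)
∈dom-⟦⟧⊕ s m = ∈dom-⊆ ⟦ s ⟧ (⟦ s ⟧ ⊕ m) (m⊆m⊕n ⟦ s ⟧ m) (∈dom-⟦⟧ s)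

∈dom-⟦⟧⇒≡ : ∀ (s : Fin n) → i ∈dom ⟦ s ⟧ → i ≡ s
∈dom-⟦⟧⇒≡ {i = i} s i∈⟦s⟧ with i Fin.≟ s
... | yes i≡s = i≡s
... | no  i≢s = contradiction (lookup-⟦⟧-≢ i s i≢s) i∈⟦s⟧

∈dom-⊕⁻ : ∀ (a b : Multiset n) → s ∈dom (a ⊕ b) → s ∈dom a ⊎ s ∈dom b
∈dom-⊕⁻ {s = s} a b s∈a⊕b with lookup a s ℕ.≟ 0
... | no  s∈a = inj₁ s∈a
... | yes s∉a = inj₂ λ s∉b → s∈a⊕b (trans (lookup-⊕ a b s) (cong₂ _+_ s∉a s∉b))

∈dom⇒⟦⟧⊆ : ∀ (a : Multiset n) → s ∈dom a → ⟦ s ⟧ ⊆ a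
∈dom⇒⟦⟧⊆ {s = s} a s∈a i with i Fin.≟ s
... | yes refl = subst (_≤ lookup a s) (sym (lookup-⟦⟧-≡ s)) (n≢0⇒n>0 s∈a)
... | no  i≢s  = subst (_≤ lookup a i) (sym (lookup-⟦⟧-≢ i s i≢s)) z≤n

m⊕n≡θ⇒m≡θ : ∀ (a b : Multiset n) → a ⊕ b ≡ θ → a ≡ θ
m⊕n≡θ⇒m≡θ a b eq = ≗⇒≡ λ i → trans
  (m+n≡0⇒m≡0 (lookup a i) (trans (sym (lookup-⊕ a b i)) (trans (cong (flip lookup i) eq) (lookup-θ i))))
  (sym (lookup-θ i))

size : Multiset n → ℕ
size = sum

size-θ : size (θ {n}) ≡ 0
size-θ {zero}  = refl
size-θ {suc n} = size-θ {n}

size-⊕ : ∀ (a b : Multiset n) → size (a ⊕ b) ≡ size a + size b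
size-⊕ []      []      = refl
size-⊕ (x ∷ a) (y ∷ b) = trans (cong (x + y +_) (size-⊕ a b)) (interchange x y (size a) (size b))

size-⟦⟧ : ∀ (s : Fin n) → size ⟦ s ⟧ ≡ 1
size-⟦⟧ {n = suc n} zero = cong suc (trans (cong size tabulate-0≡θ) (size-θ {n}))
  where
  tabulate-0≡θ : tabulate (λ _ → 0) ≡ θ {n}
  tabulate-0≡θ = ≗⇒≡ λ i → trans (lookup∘tabulate _ i) (sym (lookup-θ i))
size-⟦⟧ (suc s) = size-⟦⟧ s

size-⟦⟧⊕ : ∀ (s : Fin n) m → size (⟦ s ⟧ ⊕ m) ≡ suc (size m)
size-⟦⟧⊕ s m = trans (size-⊕ ⟦ s ⟧ m) (cong (_+ size m) (size-⟦⟧ s))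

size-⊖⟦⟧ : ∀ (m : Multiset n) → s ∈dom m → suc (size (m ⊖ ⟦ s ⟧)) ≡ size m
size-⊖⟦⟧ {s = s} m s∈m =
  trans (sym (size-⟦⟧⊕ s (m ⊖ ⟦ s ⟧))) (cong size (m⊕[n⊖m]≡n ⟦ s ⟧ m (∈dom⇒⟦⟧⊆ m s∈m)))

size≡0⇒≡θ : ∀ (a : Multiset n) → size a ≡ 0 → a ≡ θ
size≡0⇒≡θ []      _  = refl
size≡0⇒≡θ (x ∷ a) eq = cong₂ _∷_ (m+n≡0⇒m≡0 x eq) (size≡0⇒≡θ a (m+n≡0⇒n≡0 x eq))

lookup≤size : ∀ (a : Multiset n) i → lookup a i ≤ size a
lookup≤size (x ∷ a) zero    = m≤m+n x (size a)
lookup≤size (x ∷ a) (suc i) = ≤-trans (lookup≤size a i) (m≤n+m (size a) x)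

Bounded : ℕ → Multiset n → Set
Bounded k a = ∀ i → lookup a i < k

∀-bounded? : ∀ n k {P : Multiset n → Set} → (∀ a → Dec (P a)) → Dec (∀ a → Bounded k a → P a)
∀-bounded? zero    k P? = map′ (λ p → λ { [] _ → p }) (λ ∀p → ∀p [] λ ()) (P? [])
∀-bounded? (suc n) k {P} P? = map′ cons uncons (allUpTo? (λ x → ∀-bounded? n k (P? ∘ (x ∷_))) k)
  where
  cons : (∀ {x} → x < k → ∀ a → Bounded k a → P (x ∷ a)) → ∀ a → Bounded k a → P a
  cons ∀p (x ∷ a) x∷a<k = ∀p (x∷a<k zero) a (x∷a<k ∘ suc)

  uncons : (∀ a → Bounded k a → P a) → ∀ {x} → x < k → ∀ a → Bounded k a → P (x ∷ a)
  uncons ∀p x<k a a<k = ∀p (_ ∷ a) λ { zero → x<k ; (suc i) → a<k i }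

⊕[]-flip : m₁ ⊕[ R ] m₂ → m₂ ⊕[ flip R ] m₁
⊕[]-flip base       = base
⊕[]-flip (step r d) = step r (⊕[]-flip d)

⊕[]-size : m₁ ⊕[ R ] m₂ → size m₁ ≡ size m₂
⊕[]-size base = refl
⊕[]-size (step {s₁ = s₁} {s₂} {m₁} {m₂} r d) =
  trans (size-⟦⟧⊕ s₁ m₁) (trans (cong suc (⊕[]-size d)) (sym (size-⟦⟧⊕ s₂ m₂)))

⊕[]-θ : ∀ {n} {R : PlaceRel n} {m} → θ ⊕[ R ] m → m ≡ θ
⊕[]-θ {n} {m = m} d = size≡0⇒≡θ m (trans (sym (⊕[]-size d)) (size-θ {n}))

⊕[]-bounded : m₁ ⊕[ R ] m₂ → Bounded (suc (size m₁)) m₂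
⊕[]-bounded {m₂ = m₂} d i = s≤s (subst (lookup m₂ i ≤_) (sym (⊕[]-size d)) (lookup≤size m₂ i))

⊕[]-dom : m₁ ⊕[ R ] m₂ → s₂ ∈dom m₂ → ∃ λ s₁ → R s₁ s₂ ≡ true × s₁ ∈dom m₁
⊕[]-dom {s₂ = s} base s∈θ = contradiction (lookup-θ s) s∈θ
⊕[]-dom {s₂ = s} (step {s₁ = s₁} {s₂} {m₁} {m₂} r d) s∈ with ∈dom-⊕⁻ ⟦ s₂ ⟧ m₂ s∈
... | inj₁ s∈⟦s₂⟧ with refl ← ∈dom-⟦⟧⇒≡ s₂ s∈⟦s₂⟧ = s₁ , r , ∈dom-⟦⟧⊕ s₁ m₁
... | inj₂ s∈m₂ =
  let s₁′ , r′ , s₁′∈m₁ = ⊕[]-dom d s∈m₂ in s₁′ , r′ , ∈dom-⊆ m₁ (⟦ s₁ ⟧ ⊕ m₁) (n⊆m⊕n ⟦ s₁ ⟧ m₁) s₁′∈m₁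

⊕[]-split : m₁ ⊕[ R ] m₂ → ∀ a b → m₁ ≡ a ⊕ b →
            ∃₂ λ p q → m₂ ≡ p ⊕ q × a ⊕[ R ] p × b ⊕[ R ] q
⊕[]-split base a b θ≡a⊕b
  with refl ← m⊕n≡θ⇒m≡θ a b (sym θ≡a⊕b) | refl ← m⊕n≡θ⇒m≡θ b a (trans (⊕-comm b a) (sym θ≡a⊕b))
  = θ , θ , sym (⊕-identityʳ θ) , base , base
⊕[]-split {R = R} (step {s₁ = s₁} {s₂} {m₁} {m₂} r d) a b e =
  [ peel a b e , (λ s₁∈b → swap-parts (peel b a (trans e (⊕-comm a b)) s₁∈b)) ]′
  (∈dom-⊕⁻ a b (subst (s₁ ∈dom_) e (∈dom-⟦⟧⊕ s₁ m₁)))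
  where
  swap-parts : ∀ {a b} → (∃₂ λ p q → ⟦ s₂ ⟧ ⊕ m₂ ≡ p ⊕ q × a ⊕[ R ] p × b ⊕[ R ] q) →
                         (∃₂ λ p q → ⟦ s₂ ⟧ ⊕ m₂ ≡ p ⊕ q × b ⊕[ R ] p × a ⊕[ R ] q)
  swap-parts (p , q , eq , aRp , bRq) = q , p , trans eq (⊕-comm p q) , bRq , aRp

  peel : ∀ a b → ⟦ s₁ ⟧ ⊕ m₁ ≡ a ⊕ b → s₁ ∈dom a →
         ∃₂ λ p q → ⟦ s₂ ⟧ ⊕ m₂ ≡ p ⊕ q × a ⊕[ R ] p × b ⊕[ R ] q
  peel a b e s₁∈a =
    let p , q , m₂≡p⊕q , a′Rp , bRq = ⊕[]-split d (a ⊖ ⟦ s₁ ⟧) b m₁≡a′⊕b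
    in ⟦ s₂ ⟧ ⊕ p , q , trans (cong (⟦ s₂ ⟧ ⊕_) m₂≡p⊕q) (sym (⊕-assoc ⟦ s₂ ⟧ p q)) ,
       subst (_⊕[ R ] (⟦ s₂ ⟧ ⊕ p)) a-split (step r a′Rp) , bRq
    where
    a-split : ⟦ s₁ ⟧ ⊕ (a ⊖ ⟦ s₁ ⟧) ≡ a
    a-split = m⊕[n⊖m]≡n ⟦ s₁ ⟧ a (∈dom⇒⟦⟧⊆ a s₁∈a)

    m₁≡a′⊕b : m₁ ≡ (a ⊖ ⟦ s₁ ⟧) ⊕ b
    m₁≡a′⊕b = ⊕-cancelˡ ⟦ s₁ ⟧ (begin
      ⟦ s₁ ⟧ ⊕ m₁                  ≡⟨ e ⟩
      a ⊕ b                        ≡⟨ cong (_⊕ b) a-split ⟨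
      (⟦ s₁ ⟧ ⊕ (a ⊖ ⟦ s₁ ⟧)) ⊕ b  ≡⟨ ⊕-assoc ⟦ s₁ ⟧ (a ⊖ ⟦ s₁ ⟧) b ⟩
      ⟦ s₁ ⟧ ⊕ ((a ⊖ ⟦ s₁ ⟧) ⊕ b)  ∎)
      where open ≡-Reasoning

Removable : PlaceRel n → Multiset n → Multiset n → Fin n → Fin n → Set
Removable R m₁ m₂ s₁ s₂ =
  s₁ ∈dom m₁ × s₂ ∈dom m₂ × R s₁ s₂ ≡ true × (m₁ ⊖ ⟦ s₁ ⟧) ⊕[ R ] (m₂ ⊖ ⟦ s₂ ⟧)

removable⇒⊕[] : Removable R m₁ m₂ s₁ s₂ → m₁ ⊕[ R ] m₂
removable⇒⊕[] {R = R} {m₁} {m₂} {s₁} {s₂} (s₁∈m₁ , s₂∈m₂ , r , d) =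
  subst₂ _⊕[ R ]_ (m⊕[n⊖m]≡n ⟦ s₁ ⟧ m₁ (∈dom⇒⟦⟧⊆ m₁ s₁∈m₁)) (m⊕[n⊖m]≡n ⟦ s₂ ⟧ m₂ (∈dom⇒⟦⟧⊆ m₂ s₂∈m₂))
    (step r d)

⊕[]⇒removable : m₁ ⊕[ R ] m₂ → m₁ ≢ θ → ∃₂ (Removable R m₁ m₂)
⊕[]⇒removable base θ≢θ = contradiction refl θ≢θ
⊕[]⇒removable {R = R} (step {s₁ = s₁} {s₂} {m₁} {m₂} r d) _ =
  s₁ , s₂ , ∈dom-⟦⟧⊕ s₁ m₁ , ∈dom-⟦⟧⊕ s₂ m₂ , r ,
  subst₂ _⊕[ R ]_ (sym (m⊕n⊖m≡n ⟦ s₁ ⟧ m₁)) (sym (m⊕n⊖m≡n ⟦ s₂ ⟧ m₂)) d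

⊕[]? : ∀ (R : PlaceRel n) m₁ m₂ → Dec (m₁ ⊕[ R ] m₂)
⊕[]? {n} R m₁ m₂ = bySize (size m₁) m₁ m₂ refl
  where
  bySize : ∀ k m₁ m₂ → size m₁ ≡ k → Dec (m₁ ⊕[ R ] m₂)
  bySize zero m₁ m₂ size≡0 with refl ← size≡0⇒≡θ m₁ size≡0 =
    map′ (λ { refl → base }) ⊕[]-θ (≡-dec ℕ._≟_ m₂ θ)
  bySize (suc k) m₁ m₂ size≡1+k =
    map′ (λ { (_ , _ , rem) → removable⇒⊕[] rem }) (λ d → ⊕[]⇒removable d m₁≢θ)
         (any? λ s₁ → any? λ s₂ → removable? s₁ s₂)
    where
    m₁≢θ : m₁ ≢ θ
    m₁≢θ m₁≡θ = 0≢1+n (trans (sym (size-θ {n})) (trans (cong size (sym m₁≡θ)) size≡1+k))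

    removable? : ∀ s₁ s₂ → Dec (Removable R m₁ m₂ s₁ s₂)
    removable? s₁ s₂ with s₁ ∈dom? m₁
    ... | no  s₁∉m₁ = no (s₁∉m₁ ∘ proj₁)
    ... | yes s₁∈m₁ = map′ (s₁∈m₁ ,_) proj₂ (s₂ ∈dom? m₂ ×-dec R s₁ s₂ Bool.≟ true ×-dec
                        bySize k _ _ (suc-injective (trans (size-⊖⟦⟧ m₁ s₁∈m₁) size≡1+k)))

⊖≡θ⇒≡ : ∀ (a b : Multiset n) → a ⊆ b → b ⊖ a ≡ θ → a ≡ b
⊖≡θ⇒≡ a b a⊆b b⊖a≡θ = begin
  a              ≡⟨ ⊕-identityʳ a ⟨
  a ⊕ θ          ≡⟨ cong (a ⊕_) b⊖a≡θ ⟨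
  a ⊕ (b ⊖ a)    ≡⟨ m⊕[n⊖m]≡n a b a⊆b ⟩
  b              ∎
  where open ≡-Reasoning

module _ (N : PTINet) where
  open PTINet N

  enabled? : ∀ m t → Dec (Enabled N m t)
  enabled? m t = pre t ⊆? m ×-dec all? λ s → inh s t Bool.≟ true →-dec ¬? (s ∈dom? m)

  enabled-pre : ∀ m t → Enabled N m t → Enabled N (pre t) t
  enabled-pre m t (pre⊆m , uninhibited) =
    (λ _ → ≤-refl) , λ s s-inh s∈pre → uninhibited s s-inh (∈dom-⊆ (pre t) m pre⊆m s∈pre)

  uninhibited-⊕[] : ∀ {R m₁ m₂ t₁ t₂} → m₁ ⊕[ R ] m₂ → Enabled N m₁ t₁ →
                    (∀ s s′ → R s s′ ≡ true → inh s′ t₂ ≡ true → inh s t₁ ≡ true) →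
                    ∀ s′ → inh s′ t₂ ≡ true → ¬ (s′ ∈dom m₂)
  uninhibited-⊕[] d (_ , uninhibited) inh⇐ s′ s′-inh s′∈m₂ =
    let s , r , s∈m₁ = ⊕[]-dom d s′∈m₂ in uninhibited s (inh⇐ s s′ r s′-inh) s∈m₁

  matches? : ∀ R m₁ t₁ m₂ t₂ → Dec (Matches N R m₁ t₁ m₂ t₂)
  matches? R m₁ t₁ m₂ t₂ =
    ⊕[]? R (pre t₁) (pre t₂) ×-dec ⊕[]? R (post t₁) (post t₂) ×-dec lab t₁ Fin.≟ lab t₂ ×-dec
    ⊕[]? R (m₁ ⊖ pre t₁) (m₂ ⊖ pre t₂) ×-dec
    (all? λ s → all? λ s′ → R s s′ Bool.≟ true →-dec
      ((inh s t₁ Bool.≟ true →-dec inh s′ t₂ Bool.≟ true) ×-dec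
       (inh s′ t₂ Bool.≟ true →-dec inh s t₁ Bool.≟ true)))

  matches-flip : ∀ {R m₁ t₁ m₂ t₂} → Matches N R m₁ t₁ m₂ t₂ → Matches N (flip R) m₂ t₂ m₁ t₁
  matches-flip (pre-R , post-R , lab≡ , rest-R , inh⇔) =
    ⊕[]-flip pre-R , ⊕[]-flip post-R , sym lab≡ , ⊕[]-flip rest-R , λ s s′ r → swap (inh⇔ s′ s r)

  Forth : PlaceRel nS → Multiset nS → Multiset nS → Set
  Forth R m₁ m₂ = ∀ t₁ → Enabled N m₁ t₁ → ∃ λ t₂ → Enabled N m₂ t₂ × Matches N R m₁ t₁ m₂ t₂

  Back : PlaceRel nS → Multiset nS → Multiset nS → Set
  Back R m₁ m₂ = ∀ t₂ → Enabled N m₂ t₂ → ∃ λ t₁ → Enabled N m₁ t₁ × Matches N R m₁ t₁ m₂ t₂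

  forth-flip⇒back : ∀ {R m₁ m₂} → Forth (flip R) m₂ m₁ → Back R m₁ m₂
  forth-flip⇒back forth t₂ en₂ = let t₁ , en₁ , match = forth t₂ en₂ in t₁ , en₁ , matches-flip match

  back⇒forth-flip : ∀ {R m₁ m₂} → Back R m₁ m₂ → Forth (flip R) m₂ m₁
  back⇒forth-flip back t₂ en₂ = let t₁ , en₁ , match = back t₂ en₂ in t₁ , en₁ , matches-flip match

  forth? : ∀ R m₁ m₂ → Dec (Forth R m₁ m₂)
  forth? R m₁ m₂ = all? λ t₁ → enabled? m₁ t₁ →-dec any? λ t₂ → enabled? m₂ t₂ ×-dec matches? R m₁ t₁ m₂ t₂

  ForthOnPresets : PlaceRel nS → Set
  ForthOnPresets R = ∀ t m → pre t ⊕[ R ] m → Forth R (pre t) m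

  forthOnPresets? : ∀ R → Dec (ForthOnPresets R)
  forthOnPresets? R = all? λ t →
    Dec.map (unbound t) (∀-bounded? nS _ λ m → ⊕[]? R (pre t) m →-dec forth? R (pre t) m)
    where
    unbound : ∀ t → (∀ m → Bounded (suc (size (pre t))) m → pre t ⊕[ R ] m → Forth R (pre t) m)
                  ⇔ (∀ m → pre t ⊕[ R ] m → Forth R (pre t) m)
    unbound t = mk⇔ (λ ∀m m d → ∀m m (⊕[]-bounded d) d) (λ ∀m m _ → ∀m m)

  forth-extends : ∀ {R m₁ m₂} → ForthOnPresets R → m₁ ⊕[ R ] m₂ → Forth R m₁ m₂
  forth-extends {R} {m₁} F d t₁ en₁
    with ⊕[]-split d (pre t₁) (m₁ ⊖ pre t₁) (sym (m⊕[n⊖m]≡n (pre t₁) m₁ (proj₁ en₁)))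
  ... | p , q , refl , pre₁Rp , rest₁Rq
    with F t₁ p pre₁Rp t₁ (enabled-pre m₁ t₁ en₁)
  ... | t₂ , (pre₂⊆p , _) , pre-R , post-R , lab≡ , leftover , inh⇔
    -- (•t₁ ⊖ •t₁) R^⊕ (p ⊖ •t₂) forces p ⊖ •t₂ = θ, hence •t₂ = p
    with refl ← ⊖≡θ⇒≡ (pre t₂) p pre₂⊆p (⊕[]-θ (subst (_⊕[ R ] (p ⊖ pre t₂)) (m⊖m≡θ (pre t₁)) leftover))
    = t₂
    , (m⊆m⊕n (pre t₂) q , uninhibited-⊕[] d en₁ λ s s′ r → proj₂ (inh⇔ s s′ r))
    , pre-R , post-R , lab≡ , subst ((m₁ ⊖ pre t₁) ⊕[ R ]_) (sym (m⊕n⊖m≡n (pre t₂) q)) rest₁Rq , inh⇔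

  forthOnPresets⇔bisim : ∀ R → (ForthOnPresets R × ForthOnPresets (flip R)) ⇔ IsPtiPlaceBisim N R
  forthOnPresets⇔bisim R = mk⇔
    (λ (F , F′) m₁ m₂ d → forth-extends F d , forth-flip⇒back (forth-extends F′ (⊕[]-flip d)))
    (λ bisim → (λ t m d → proj₁ (bisim (pre t) m d))
             , (λ t m d → back⇒forth-flip (proj₂ (bisim m (pre t) (⊕[]-flip d)))))

lemma29 : (N : PTINet) → (R : PlaceRel (PTINet.nS N)) → Dec (IsPtiPlaceBisim N R)
lemma29 N R = Dec.map (forthOnPresets⇔bisim N R) (forthOnPresets? N R ×-dec forthOnPresets? N (flip R))
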